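{- Suppose that the modal operator $\bullet$ occurs neither in any type of $\Gamma$ nor in $A$. If $\Gamma\vdash M:A$ is derivable in $\lambda\mathbf A$, then $M$ is normalizable (has a $\beta$-normal form).
   Context: Type expressions. Pseudo type expressions: $A::=X\mid A\to B\mid\bullet A\mid\mu X.A$ ($\alpha$-equivalent ones identified; $A[B/X]$ capture-avoiding substitution). $\top:=\mu X.\bullet X$. Tail: $t(X)=X$, $t(A\to B)=t(B)$, $t(\bullet A)=\bullet t(A)$, $t(\mu X.A)=\mu X.t(A)$. $A$ is a $\top$-variant iff $t(A)=\bullet^{m_0}\mu X_1.\bullet^{m_1}\cdots\mu X_n.\bullet^{m_n}X_i$ with $1\le i\le n$, $X_i\notin\{X_{i+1},\dots,X_n\}$, $m_i+\dots+m_n\ge1$. Properness in $X$: variable $Y$ iff $Y\ne X$; $\bullet A$ always; $A\to B$ iff both are or $B$ is a $\top$-variant; $\mu Y.A$ ($Y\ne X$) iff $A$ is or $\mu Y.A$ is a $\top$-variant. Type expressions: every $\mu X.A$ has $A$ proper in $X$. Equality $\simeq$: smallest relation closed under reflexivity, symmetry, transitivity, $\bullet$- and $\to$-congruence, $A\to\top\simeq\top$, $\mu X.A\simeq A[\mu X.A/X]$, ($A\simeq C[A/X]$, $C$ proper in $X$) $\Rightarrow A\simeq\mu X.C$, and $\bullet(A\to B)\simeq\bullet A\to\bullet B$. $A\preceq B$ means $\emptyset\vdash A\preceq B$ derivable, where $\gamma$ ranges over finite sets of pairs $X\preceq Y$ of type variables each occurring at most once, by: $\gamma\cup\{X\preceq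 Y\}\vdash X\preceq Y$; $\gamma\vdash A\preceq\top$; $A\simeq B\Rightarrow\gamma\vdash A\preceq B$; transitivity (union of assumptions); $\bullet$-monotonicity; $\gamma_1\vdash A'\preceq A,\gamma_2\vdash B\preceq B'\Rightarrow\gamma_1\cup\gamma_2\vdash A\to B\preceq A'\to B'$; $\gamma\cup\{X\preceq Y\}\vdash A\preceq B\Rightarrow\gamma\vdash\mu X.A\preceq\mu Y.B$ if $X$ not free in $\gamma,B$, $Y$ not free in $\gamma,A$, $A$ proper in $X$, $B$ proper in $Y$; $\gamma\vdash A\preceq\bullet A$. Typing system $\lambda\mathbf A$: typing contexts are finite maps from individual variables to type expressions; $\bullet\Gamma$ maps $x\mapsto\bullet\Gamma(x)$; unions must agree on common variables. Rules: $\Gamma\cup\{x:A\}\vdash x:A$; from $\bullet\Gamma\vdash M:\bullet A$ infer $\Gamma\vdash M:A$; $\Gamma\vdash M:\top$; from $\Gamma\vdash M:A$ and $A\preceq B$ infer $\Gamma\vdash M:B$; from $\Gamma\cup\{x:A\}\vdash M:B$ infer $\Gamma\vdash\lambda x.M:A\to B$; from $\Gamma_1\vdash M:A\to B$ and $\Gamma_2\vdash N:A$ infer $\Gamma_1\cup\Gamma_2\vdash MN:B$. -}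

module Defs where

open import Data.Nat using (ℕ; zero; suc; _≡ᵇ_; _<ᵇ_; pred)
open import Data.Bool using (if_then_else_)
open import Data.Maybe using (Maybe; just; nothing)
import Data.Maybe as Maybe
open import Data.List using (List; []; _∷_; _++_)
import Data.List as List
open import Data.List.Membership.Propositional using (_∈_)
open import Data.Product using (_×_; _,_; ∃; ∃-syntax)
open import Data.Sum using (_⊎_)
open import Data.Unit using (⊤; tt)
open import Data.Empty using (⊥)
open import Relation.Nullary using (¬_)
open import Relation.Binary.PropositionalEquality using (_≡_; _≢_)
open import Relation.Binary.Construct.Closure.ReflexiveTransitive using (Star)

-- Pseudo type expressions, locally nameless representation:
-- free type variables are names (fv X, X : ℕ), bound ones are
-- de Bruijn indices (bv i); α-equivalent expressions are thus
-- syntactically equal.  μ A binds index 0 in A.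

infixr 7 _⇒_

data Ty : Set where
  fv  : ℕ → Ty
  bv  : ℕ → Ty
  _⇒_ : Ty → Ty → Ty
  ●   : Ty → Ty
  μ   : Ty → Ty

openRec : ℕ → Ty → Ty → Ty
openRec k U (fv X)  = fv X
openRec k U (bv i)  = if i ≡ᵇ k then U else bv i
openRec k U (A ⇒ B) = openRec k U A ⇒ openRec k U B
openRec k U (● A)   = ● (openRec k U A)
openRec k U (μ A)   = μ (openRec (suc k) U A)

openT : Ty → Ty → Ty
openT A U = openRec 0 U A

closeRec : ℕ → ℕ → Ty → Ty
closeRec k X (fv Y)  = if X ≡ᵇ Y then bv k else fv Y
closeRec k X (bv i)  = bv i
closeRec k X (A ⇒ B) = closeRec k X A ⇒ closeRec k X B
closeRec k X (● A)   = ● (closeRec k X A)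
closeRec k X (μ A)   = μ (closeRec (suc k) X A)

closeT : ℕ → Ty → Ty
closeT X A = closeRec 0 X A

-- substitution A[U/X] of a (locally closed) type U for the free name X
substT : ℕ → Ty → Ty → Ty
substT X U (fv Y)  = if X ≡ᵇ Y then U else fv Y
substT X U (bv i)  = bv i
substT X U (A ⇒ B) = substT X U A ⇒ substT X U B
substT X U (● A)   = ● (substT X U A)
substT X U (μ A)   = μ (substT X U A)

_∉FV_ : ℕ → Ty → Set
X ∉FV fv Y  = X ≢ Y
X ∉FV bv i  = ⊤
X ∉FV (A ⇒ B) = X ∉FV A × X ∉FV B
X ∉FV ● A   = X ∉FV A
X ∉FV μ A   = X ∉FV A

Top : Ty
Top = μ (● (bv 0))

tail : Ty → Ty
tail (fv X)  = fv X
tail (bv i)  = bv i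
tail (A ⇒ B) = tail B
tail (● A)   = ● (tail A)
tail (μ A)   = μ (tail A)

-- Shapes •^{m0} μX1.•^{m1} ... μXn.•^{mn} Xi.
-- Plain j A : A is a •/μ-chain ending in the variable bound j binders
--             outside A.
data Plain : ℕ → Ty → Set where
  pl-var : ∀ {j} → Plain j (bv j)
  pl-●   : ∀ {j A} → Plain j A → Plain j (● A)
  pl-μ   : ∀ {j A} → Plain (suc j) A → Plain j (μ A)

data Guarded : ℕ → Ty → Set where
  gd-●   : ∀ {j A} → Plain j A → Guarded j (● A)
  gd-μ   : ∀ {j A} → Guarded (suc j) A → Guarded j (μ A)

-- TopShape A : A = •^{m0} μX1.•^{m1} ... μXn.•^{mn} Xi with
-- 1 ≤ i ≤ n, Xi ∉ {X(i+1),...,Xn}, mi+...+mn ≥ 1.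
data TopShape : Ty → Set where
  ts-●   : ∀ {A} → TopShape A → TopShape (● A)
  ts-μ   : ∀ {A} → TopShape A → TopShape (μ A)
  ts-hit : ∀ {A} → Guarded 0 A → TopShape (μ A)

TopVariant : Ty → Set
TopVariant A = TopShape (tail A)

Proper : ℕ → Ty → Set
Proper X (fv Y)  = X ≢ Y
Proper X (bv i)  = ⊤        -- bound variables are distinct from X
Proper X (A ⇒ B) = (Proper X A × Proper X B) ⊎ TopVariant B
Proper X (● A)   = ⊤
Proper X (μ A)   = Proper X A ⊎ TopVariant (μ A)

-- type expressions: every μX.A has A proper in X
data WF : Ty → Set where
  wf-fv : ∀ {X} → WF (fv X)
  wf-⇒  : ∀ {A B} → WF A → WF B → WF (A ⇒ B)
  wf-●  : ∀ {A} → WF A → WF (● A)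
  wf-μ  : ∀ {A} (X : ℕ) → X ∉FV A → Proper X (openT A (fv X)) →
          WF (openT A (fv X)) → WF (μ A)

infix 4 _≃_

data _≃_ : Ty → Ty → Set where
  ≃-refl  : ∀ {A} → WF A → A ≃ A
  ≃-sym   : ∀ {A B} → A ≃ B → B ≃ A
  ≃-trans : ∀ {A B C} → A ≃ B → B ≃ C → A ≃ C
  ≃-●     : ∀ {A B} → A ≃ B → ● A ≃ ● B
  ≃-⇒     : ∀ {A A' B B'} → A ≃ A' → B ≃ B' → A ⇒ B ≃ A' ⇒ B'
  ≃-⊤     : ∀ {A} → WF A → A ⇒ Top ≃ Top
  ≃-fold  : ∀ {A} → WF (μ A) → WF (openT A (μ A)) → μ A ≃ openT A (μ A)
  ≃-uniq  : ∀ {A C} (X : ℕ) → WF C → Proper X C →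
            A ≃ substT X A C → A ≃ μ (closeT X C)
  ≃-●⇒    : ∀ {A B} → WF A → WF B → ● (A ⇒ B) ≃ ● A ⇒ ● B

-- Subtyping ≼ with assumption sets γ (finite sets of pairs X ≼ Y,
-- represented by lists up to set equality)

Asm : Set
Asm = List (ℕ × ℕ)

_≐_ : Asm → Asm → Set
γ ≐ δ = ∀ {p} → (p ∈ γ → p ∈ δ) × (p ∈ δ → p ∈ γ)

_occursIn_ : ℕ → ℕ × ℕ → Set
Z occursIn (X , Y) = Z ≡ X ⊎ Z ≡ Y

_∉γ_ : ℕ → Asm → Set
Z ∉γ γ = ∀ {p} → p ∈ γ → ¬ (Z occursIn p)

WFγ : Asm → Set
WFγ γ = (∀ {X Y} → (X , Y) ∈ γ → X ≢ Y) ×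
        (∀ {p q Z} → p ∈ γ → q ∈ γ → Z occursIn p → Z occursIn q → p ≡ q)

infix 4 _⊢_≼_

data _⊢_≼_ : Asm → Ty → Ty → Set where
  ≼-hyp   : ∀ {γ X Y} → WFγ γ → (X , Y) ∈ γ → γ ⊢ fv X ≼ fv Y
  ≼-⊤     : ∀ {γ A} → WFγ γ → WF A → γ ⊢ A ≼ Top
  ≼-≃     : ∀ {γ A B} → WFγ γ → A ≃ B → γ ⊢ A ≼ B
  ≼-trans : ∀ {γ γ₁ γ₂ A B C} → WFγ γ → γ ≐ (γ₁ ++ γ₂) →
            γ₁ ⊢ A ≼ B → γ₂ ⊢ B ≼ C → γ ⊢ A ≼ C
  ≼-●     : ∀ {γ A B} → γ ⊢ A ≼ B → γ ⊢ ● A ≼ ● B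
  ≼-⇒     : ∀ {γ γ₁ γ₂ A A' B B'} → WFγ γ → γ ≐ (γ₁ ++ γ₂) →
            γ₁ ⊢ A' ≼ A → γ₂ ⊢ B ≼ B' → γ ⊢ A ⇒ B ≼ A' ⇒ B'
  -- μX.A ≼ μY.B, bodies written in locally nameless form: the named
  -- bodies are openT A (fv X) and openT B (fv Y)
  ≼-μ     : ∀ {γ γ' A B} (X Y : ℕ) → X ≢ Y →
            X ∉γ γ → Y ∉γ γ →
            X ∉FV A → X ∉FV B → Y ∉FV A → Y ∉FV B →
            Proper X (openT A (fv X)) → Proper Y (openT B (fv Y)) →
            γ' ≐ ((X , Y) ∷ γ) →
            γ' ⊢ openT A (fv X) ≼ openT B (fv Y) →
            γ ⊢ μ A ≼ μ B
  ≼-next  : ∀ {γ A} → WFγ γ → WF A → γ ⊢ A ≼ ● A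

_≼_ : Ty → Ty → Set
A ≼ B = [] ⊢ A ≼ B

infixl 7 _·_

data Tm : Set where
  var : ℕ → Tm
  ƛ   : Tm → Tm
  _·_ : Tm → Tm → Tm

shift : ℕ → Tm → Tm
shift c (var x) = if x <ᵇ c then var x else var (suc x)
shift c (ƛ M)   = ƛ (shift (suc c) M)
shift c (M · N) = shift c M · shift c N

-- substitute N for index j, decrementing the indices above j
sub : ℕ → Tm → Tm → Tm
sub j N (var x) = if x <ᵇ j then var x else (if x ≡ᵇ j then N else var (pred x))
sub j N (ƛ M)   = ƛ (sub (suc j) (shift 0 N) M)
sub j N (M · M') = sub j N M · sub j N M'

infix 4 _⟶β_

data _⟶β_ : Tm → Tm → Set where
  β    : ∀ {M N} → (ƛ M) · N ⟶β sub 0 N M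
  ξ-ƛ  : ∀ {M M'} → M ⟶β M' → ƛ M ⟶β ƛ M'
  ξ-·₁ : ∀ {M M' N} → M ⟶β M' → M · N ⟶β M' · N
  ξ-·₂ : ∀ {M N N'} → N ⟶β N' → M · N ⟶β M · N'

_⟶β*_ : Tm → Tm → Set
_⟶β*_ = Star _⟶β_

NF : Tm → Set
NF M = ∀ {N} → ¬ (M ⟶β N)

Normalizable : Tm → Set
Normalizable M = ∃[ N ] (M ⟶β* N × NF N)

-- Typing contexts: finite maps from (de Bruijn) individual variables
-- to type expressions, as lists of optional entries

Ctx : Set
Ctx = List (Maybe Ty)

look : Ctx → ℕ → Maybe Ty
look []      x       = nothing
look (a ∷ Γ) zero    = a
look (a ∷ Γ) (suc x) = look Γ x

●Ctx : Ctx → Ctx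
●Ctx = List.map (Maybe.map ●)

data U : Maybe Ty → Maybe Ty → Maybe Ty → Set where
  u-nn : U nothing nothing nothing
  u-jn : ∀ {A} → U (just A) nothing (just A)
  u-nj : ∀ {A} → U nothing (just A) (just A)
  u-jj : ∀ {A} → U (just A) (just A) (just A)

Union : Ctx → Ctx → Ctx → Set
Union Γ₁ Γ₂ Γ = ∀ x → U (look Γ₁ x) (look Γ₂ x) (look Γ x)

CtxWF : Ctx → Set
CtxWF Γ = ∀ x {B} → look Γ x ≡ just B → WF B

infix 3 _⊢_∶_

data _⊢_∶_ : Ctx → Tm → Ty → Set where
  t-var : ∀ {Γ x A} → look Γ x ≡ just A → Γ ⊢ var x ∶ A
  t-●   : ∀ {Γ M A} → ●Ctx Γ ⊢ M ∶ ● A → Γ ⊢ M ∶ A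
  t-⊤   : ∀ {Γ M} → Γ ⊢ M ∶ Top
  t-≼   : ∀ {Γ M A B} → Γ ⊢ M ∶ A → A ≼ B → Γ ⊢ M ∶ B
  t-ƛ   : ∀ {Γ M A B} → WF A → (just A ∷ Γ) ⊢ M ∶ B → Γ ⊢ ƛ M ∶ A ⇒ B
  t-·   : ∀ {Γ Γ₁ Γ₂ M N A B} → Union Γ₁ Γ₂ Γ →
          Γ₁ ⊢ M ∶ A ⇒ B → Γ₂ ⊢ N ∶ A → Γ ⊢ M · N ∶ B

NoBullet : Ty → Set
NoBullet (fv X)  = ⊤
NoBullet (bv i)  = ⊤
NoBullet (A ⇒ B) = NoBullet A × NoBullet B
NoBullet (● A)   = ⊥
NoBullet (μ A)   = NoBullet A

CtxNoBullet : Ctx → Set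
CtxNoBullet Γ = ∀ x {B} → look Γ x ≡ just B → NoBullet B

module Submission where

-- A semantic type is a predicate on untyped terms indexed by a step k : ℕ.  A
-- type expression A denotes ⟦ A ⟧ ρ η, where ρ values the free type names and
-- η the bound de Bruijn indices; • lowers the step by one, and μA is defined
-- by recursion on the step, its bound variable being valued by approximations
-- that agree with μA below the current step.  Properness makes the body of μA
-- contractive, so μA is the unique fixed point of its body.  A •-free type is never a
--     ⊤-variant, so properness degenerates to freshness, and by induction on
--     well-formedness every •-free type contains the neutral WN terms and only
--     WN terms.  Soundness at the identity substitution then gives the theorem.

open import Defs
open import Data.Bool using (true; false; if_then_else_)
open import Data.Bool.Properties using (T-≡; ¬-not)
open import Data.Empty using (⊥-elim)
open import Data.List using (_∷_; _++_)
open import Data.List.Membership.Propositional using (_∈_)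
open import Data.List.Membership.Propositional.Properties using (∈-++⁺ˡ; ∈-++⁺ʳ)
open import Data.List.Relation.Unary.Any using (here; there)
open import Data.Maybe using (just; nothing)
open import Data.Nat using (ℕ; zero; suc; pred; _≡ᵇ_; _<ᵇ_; _≤_; _<_; z≤n; _<?_; _≟_)
open import Data.Nat.Induction using (<-rec)
open import Data.Nat.Properties
  using (≤-refl; ≤-trans; ≤-antisym; ≤-pred; ≤-<-trans; <⇒≤; ≮⇒≥; m<n⇒m<1+n; m≤n⇒m≤1+n;
         m≤n⇒m<n∨m≡n; ≡ᵇ⇒≡; ≡⇒≡ᵇ)
open import Data.Product using (_×_; _,_; proj₁; proj₂; Σ)
open import Data.Product.Function.NonDependent.Propositional using (_×-⇔_)
open import Data.Sum using (inj₁; inj₂)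
open import Data.Unit using (⊤; tt)
open import Function.Bundles using (_⇔_; mk⇔; module Equivalence)
import Function.Properties.Equivalence as ⇔
open import Relation.Binary.Construct.Closure.ReflexiveTransitive using (ε; _◅_; _◅◅_; gmap)
open import Relation.Binary.PropositionalEquality
  using (_≡_; _≢_; refl; sym; trans; cong; cong₂; subst; module ≡-Reasoning)
open import Relation.Nullary using (Dec; yes; no; ¬_)

open Equivalence using (to; from)

-- Part 1.  Untyped λ-calculus.

ext : (ℕ → ℕ) → ℕ → ℕ
ext f zero    = zero
ext f (suc x) = suc (f x)

ren : (ℕ → ℕ) → Tm → Tm
ren f (var x) = var (f x)
ren f (ƛ M)   = ƛ (ren (ext f) M)
ren f (M · N) = ren f M · ren f N

exts : (ℕ → Tm) → ℕ → Tm
exts σ zero    = var zero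
exts σ (suc x) = shift 0 (σ x)

psub : (ℕ → Tm) → Tm → Tm
psub σ (var x) = σ x
psub σ (ƛ M)   = ƛ (psub (exts σ) M)
psub σ (M · N) = psub σ M · psub σ N

_•_ : Tm → (ℕ → Tm) → ℕ → Tm
(N • σ) zero    = N
(N • σ) (suc x) = σ x

ren-cong : ∀ {f g} → (∀ x → f x ≡ g x) → ∀ M → ren f M ≡ ren g M
ren-cong h (var x) = cong var (h x)
ren-cong {f} {g} h (ƛ M) = cong ƛ (ren-cong ext-h M)
  where
  ext-h : ∀ x → ext f x ≡ ext g x
  ext-h zero    = refl
  ext-h (suc x) = cong suc (h x)
ren-cong h (M · N) = cong₂ _·_ (ren-cong h M) (ren-cong h N)

psub-cong : ∀ {σ τ} → (∀ x → σ x ≡ τ x) → ∀ M → psub σ M ≡ psub τ M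
psub-cong h (var x) = h x
psub-cong {σ} {τ} h (ƛ M) = cong ƛ (psub-cong exts-h M)
  where
  exts-h : ∀ x → exts σ x ≡ exts τ x
  exts-h zero    = refl
  exts-h (suc x) = cong (shift 0) (h x)
psub-cong h (M · N) = cong₂ _·_ (psub-cong h M) (psub-cong h N)

shift-ren : ∀ c M → shift c M ≡ ren (λ x → if x <ᵇ c then x else suc x) M
shift-ren c (var x) with x <ᵇ c
... | true  = refl
... | false = refl
shift-ren c (ƛ M) = cong ƛ (trans (shift-ren (suc c) M) (ren-cong lift-ext M))
  where
  lift-ext : ∀ x → (if x <ᵇ suc c then x else suc x) ≡ ext (λ x → if x <ᵇ c then x else suc x) x
  lift-ext zero = refl
  lift-ext (suc x) with x <ᵇ c
  ... | true  = refl
  ... | false = refl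
shift-ren c (M · N) = cong₂ _·_ (shift-ren c M) (shift-ren c N)

shift0-ren : ∀ M → shift 0 M ≡ ren suc M
shift0-ren M = trans (shift-ren 0 M) (ren-cong (λ _ → refl) M)

ren-ren : ∀ f g M → ren f (ren g M) ≡ ren (λ x → f (g x)) M
ren-ren f g (var x) = refl
ren-ren f g (ƛ M) = cong ƛ (trans (ren-ren (ext f) (ext g) M) (ren-cong ext-comp M))
  where
  ext-comp : ∀ x → ext f (ext g x) ≡ ext (λ x → f (g x)) x
  ext-comp zero    = refl
  ext-comp (suc x) = refl
ren-ren f g (M · N) = cong₂ _·_ (ren-ren f g M) (ren-ren f g N)

psub-ren : ∀ σ f M → psub σ (ren f M) ≡ psub (λ x → σ (f x)) M
psub-ren σ f (var x) = refl
psub-ren σ f (ƛ M) = cong ƛ (trans (psub-ren (exts σ) (ext f) M) (psub-cong exts-comp M))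
  where
  exts-comp : ∀ x → exts σ (ext f x) ≡ exts (λ x → σ (f x)) x
  exts-comp zero    = refl
  exts-comp (suc x) = refl
psub-ren σ f (M · N) = cong₂ _·_ (psub-ren σ f M) (psub-ren σ f N)

ren-psub : ∀ f σ M → ren f (psub σ M) ≡ psub (λ x → ren f (σ x)) M
ren-psub f σ (var x) = refl
ren-psub f σ (ƛ M) = cong ƛ (trans (ren-psub (ext f) (exts σ) M) (psub-cong exts-comp M))
  where
  open ≡-Reasoning
  exts-comp : ∀ x → ren (ext f) (exts σ x) ≡ exts (λ x → ren f (σ x)) x
  exts-comp zero    = refl
  exts-comp (suc x) = begin
    ren (ext f) (shift 0 (σ x))  ≡⟨ cong (ren (ext f)) (shift0-ren (σ x)) ⟩
    ren (ext f) (ren suc (σ x))  ≡⟨ ren-ren (ext f) suc (σ x) ⟩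
    ren (λ y → suc (f y)) (σ x)  ≡⟨ sym (ren-ren suc f (σ x)) ⟩
    ren suc (ren f (σ x))        ≡⟨ sym (shift0-ren (ren f (σ x))) ⟩
    shift 0 (ren f (σ x))        ∎
ren-psub f σ (M · N) = cong₂ _·_ (ren-psub f σ M) (ren-psub f σ N)

psub-psub : ∀ τ σ M → psub τ (psub σ M) ≡ psub (λ x → psub τ (σ x)) M
psub-psub τ σ (var x) = refl
psub-psub τ σ (ƛ M) = cong ƛ (trans (psub-psub (exts τ) (exts σ) M) (psub-cong exts-comp M))
  where
  open ≡-Reasoning
  exts-comp : ∀ x → psub (exts τ) (exts σ x) ≡ exts (λ x → psub τ (σ x)) x
  exts-comp zero    = refl
  exts-comp (suc x) = begin
    psub (exts τ) (shift 0 (σ x))         ≡⟨ cong (psub (exts τ)) (shift0-ren (σ x)) ⟩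
    psub (exts τ) (ren suc (σ x))         ≡⟨ psub-ren (exts τ) suc (σ x) ⟩
    psub (λ y → shift 0 (τ y)) (σ x)      ≡⟨ psub-cong (λ y → shift0-ren (τ y)) (σ x) ⟩
    psub (λ y → ren suc (τ y)) (σ x)      ≡⟨ sym (ren-psub suc τ (σ x)) ⟩
    ren suc (psub τ (σ x))                ≡⟨ sym (shift0-ren (psub τ (σ x))) ⟩
    shift 0 (psub τ (σ x))                ∎
psub-psub τ σ (M · N) = cong₂ _·_ (psub-psub τ σ M) (psub-psub τ σ N)

psub-id : ∀ M → psub var M ≡ M
psub-id (var x) = refl
psub-id (ƛ M) = cong ƛ (trans (psub-cong exts-var M) (psub-id M))
  where
  exts-var : ∀ x → exts var x ≡ var x
  exts-var zero    = refl
  exts-var (suc x) = refl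
psub-id (M · N) = cong₂ _·_ (psub-id M) (psub-id N)

ren-as-psub : ∀ f M → ren f M ≡ psub (λ x → var (f x)) M
ren-as-psub f M = trans (cong (ren f) (sym (psub-id M))) (ren-psub f var M)

subAt : ℕ → Tm → ℕ → Tm
subAt j N x = if x <ᵇ j then var x else (if x ≡ᵇ j then N else var (pred x))

sub-as-psub : ∀ j N M → sub j N M ≡ psub (subAt j N) M
sub-as-psub j N (var x) = refl
sub-as-psub j N (ƛ M) = cong ƛ (trans (sub-as-psub (suc j) (shift 0 N) M) (psub-cong (exts-subAt j) M))
  where
  exts-subAt : ∀ j x → subAt (suc j) (shift 0 N) x ≡ exts (subAt j N) x
  exts-subAt j zero = refl
  exts-subAt zero (suc zero) = refl
  exts-subAt (suc j) (suc zero) = refl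
  exts-subAt j (suc (suc x)) with suc x <ᵇ j | suc x ≡ᵇ j
  ... | true  | _     = refl
  ... | false | true  = refl
  ... | false | false = refl
sub-as-psub j N (M · M') = cong₂ _·_ (sub-as-psub j N M) (sub-as-psub j N M')

beta-psub : ∀ N σ M → sub 0 N (psub (exts σ) M) ≡ psub (N • σ) M
beta-psub N σ M = begin
  sub 0 N (psub (exts σ) M)                     ≡⟨ sub-as-psub 0 N (psub (exts σ) M) ⟩
  psub (subAt 0 N) (psub (exts σ) M)            ≡⟨ psub-psub (subAt 0 N) (exts σ) M ⟩
  psub (λ x → psub (subAt 0 N) (exts σ x)) M    ≡⟨ psub-cong subAt-exts M ⟩
  psub (N • σ) M                                ∎
  where
  open ≡-Reasoning
  subAt-exts : ∀ x → psub (subAt 0 N) (exts σ x) ≡ (N • σ) x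
  subAt-exts zero    = refl
  subAt-exts (suc x) = trans (cong (psub (subAt 0 N)) (shift0-ren (σ x)))
                             (trans (psub-ren (subAt 0 N) suc (σ x)) (psub-id (σ x)))

ren-sub0 : ∀ f M N → sub 0 (ren f N) (ren (ext f) M) ≡ ren f (sub 0 N M)
ren-sub0 f M N = begin
  sub 0 (ren f N) (ren (ext f) M)                   ≡⟨ sub-as-psub 0 (ren f N) (ren (ext f) M) ⟩
  psub (subAt 0 (ren f N)) (ren (ext f) M)          ≡⟨ psub-ren _ (ext f) M ⟩
  psub (λ x → subAt 0 (ren f N) (ext f x)) M        ≡⟨ psub-cong subAt-ext M ⟩
  psub (λ x → ren f (subAt 0 N x)) M                ≡⟨ sym (ren-psub f (subAt 0 N) M) ⟩
  ren f (psub (subAt 0 N) M)                        ≡⟨ cong (ren f) (sym (sub-as-psub 0 N M)) ⟩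
  ren f (sub 0 N M)                                 ∎
  where
  open ≡-Reasoning
  subAt-ext : ∀ x → subAt 0 (ren f N) (ext f x) ≡ ren f (subAt 0 N x)
  subAt-ext zero    = refl
  subAt-ext (suc x) = refl

ren-step : ∀ f {M M'} → M ⟶β M' → ren f M ⟶β ren f M'
ren-step f (β {M} {N}) = subst (ren f ((ƛ M) · N) ⟶β_) (ren-sub0 f M N) β
ren-step f (ξ-ƛ s)  = ξ-ƛ (ren-step (ext f) s)
ren-step f (ξ-·₁ s) = ξ-·₁ (ren-step f s)
ren-step f (ξ-·₂ s) = ξ-·₂ (ren-step f s)

ren-reflect : ∀ f M {P} → ren f M ⟶β P → Σ Tm (λ M' → (M ⟶β M') × (P ≡ ren f M'))
ren-reflect f (ƛ M) (ξ-ƛ s) with ren-reflect (ext f) M s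
... | M' , s' , refl = ƛ M' , ξ-ƛ s' , refl
ren-reflect f ((ƛ M) · N) β = sub 0 N M , β , ren-sub0 f M N
ren-reflect f (M · N) (ξ-·₁ s) with ren-reflect f M s
... | M' , s' , refl = M' · N , ξ-·₁ s' , refl
ren-reflect f (M · N) (ξ-·₂ s) with ren-reflect f N s
... | N' , s' , refl = M · N' , ξ-·₂ s' , refl

WN-unren : ∀ f M → Normalizable (ren f M) → Normalizable M
WN-unren f M (P , r , nf) = along r
  where
  along : ∀ {M} → ren f M ⟶β* P → Normalizable M
  along {M} ε = M , ε , λ s → nf (ren-step f s)
  along {M} (s ◅ r) with ren-reflect f M s
  ... | M' , s' , refl with along r
  ...   | Q , r' , nf' = Q , s' ◅ r' , nf'

WN-expand : ∀ {M M'} → M ⟶β M' → Normalizable M' → Normalizable M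
WN-expand s (N , r , nf) = N , s ◅ r , nf

WN-ƛ : ∀ {M} → Normalizable M → Normalizable (ƛ M)
WN-ƛ (N , r , nf) = ƛ N , gmap ƛ ξ-ƛ r , λ { (ξ-ƛ s) → nf s }

WN-app-var : ∀ M y → Normalizable (M · var y) → Normalizable M
WN-app-var M y (N , ε , nf) = M , ε , λ s → nf (ξ-·₁ s)
WN-app-var (ƛ M) y (N , β ◅ r , nf) =
  WN-ƛ (WN-unren (rename-0 y) M (N , subst (_⟶β* N) (sub-var M) r , nf))
  where
  rename-0 : ℕ → ℕ → ℕ
  rename-0 y zero    = y
  rename-0 y (suc x) = x
  sub-var : ∀ M → sub 0 (var y) M ≡ ren (rename-0 y) M
  sub-var M = trans (sub-as-psub 0 (var y) M)
                    (trans (psub-cong (λ { zero → refl ; (suc x) → refl }) M)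
                           (sym (ren-as-psub (rename-0 y) M)))
WN-app-var M y (N , ξ-·₁ s ◅ r , nf) with WN-app-var _ y (N , r , nf)
... | N' , r' , nf' = N' , s ◅ r' , nf'
WN-app-var M y (N , ξ-·₂ () ◅ r , nf)

data NeutralNF : Tm → Set where
  nf-var : ∀ {x} → NeutralNF (var x)
  nf-app : ∀ {M N} → NeutralNF M → NF N → NeutralNF (M · N)

NeutralNF⇒NF : ∀ {M} → NeutralNF M → NF M
NeutralNF⇒NF nf-var ()
NeutralNF⇒NF (nf-app () _) β
NeutralNF⇒NF (nf-app nM _) (ξ-·₁ s) = NeutralNF⇒NF nM s
NeutralNF⇒NF (nf-app _ nN) (ξ-·₂ s) = nN s

data Neutral : Tm → Set where
  ne-var : ∀ {x} → Neutral (var x)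
  ne-app : ∀ {M N} → Neutral M → Normalizable N → Neutral (M · N)

Neutral-reduces-to-NF : ∀ {M} → Neutral M → Σ Tm (λ M' → (M ⟶β* M') × NeutralNF M')
Neutral-reduces-to-NF ne-var = _ , ε , nf-var
Neutral-reduces-to-NF (ne-app {M} {N} nM (N' , rN , nfN)) with Neutral-reduces-to-NF nM
... | M' , rM , nM' = M' · N' , gmap (_· N) ξ-·₁ rM ◅◅ gmap (M' ·_) ξ-·₂ rN , nf-app nM' nfN

Neutral⇒WN : ∀ {M} → Neutral M → Normalizable M
Neutral⇒WN n with Neutral-reduces-to-NF n
... | M' , r , nM' = M' , r , NeutralNF⇒NF nM'

-- Part 2.  The step-indexed model and its structural properties.

SemTy : Set₁
SemTy = ℕ → Tm → Set

Env : Set₁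
Env = ℕ → SemTy

_∷ₑ_ : SemTy → Env → Env
(S ∷ₑ η) zero    = S
(S ∷ₑ η) (suc i) = η i

-- Case distinction on a decision, computing on the decision itself, so that
-- proofs can split on `j <? k` and keep the evidence.
caseDec : {P : Set} {B : Set₁} → Dec P → B → B → B
caseDec (yes _) x y = x
caseDec (no _)  x y = y

mutual
  -- The arrow and μ clauses at step k+1 repeat step k, so
  -- that the interpretation is downward closed.
  ⟦_⟧ : Ty → Env → Env → SemTy
  ⟦ fv X ⟧  ρ η k M       = ρ X k M
  ⟦ bv i ⟧  ρ η k M       = η i k M
  ⟦ A ⇒ B ⟧ ρ η zero M    = ∀ N → ⟦ A ⟧ ρ η zero N → ⟦ B ⟧ ρ η zero (M · N)
  ⟦ A ⇒ B ⟧ ρ η (suc k) M = ⟦ A ⇒ B ⟧ ρ η k M ×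
                            (∀ N → ⟦ A ⟧ ρ η (suc k) N → ⟦ B ⟧ ρ η (suc k) (M · N))
  ⟦ ● A ⟧   ρ η zero M    = ⊤
  ⟦ ● A ⟧   ρ η (suc k) M = ⟦ A ⟧ ρ η k M
  ⟦ μ A ⟧   ρ η zero M    = ⟦ A ⟧ ρ (approx A ρ η zero ∷ₑ η) zero M
  ⟦ μ A ⟧   ρ η (suc k) M = ⟦ μ A ⟧ ρ η k M × ⟦ A ⟧ ρ (approx A ρ η (suc k) ∷ₑ η) (suc k) M

  -- approx A ρ η k: the value of the bound variable of μA at step k.  It is
  -- ⟦ μ A ⟧ below step k (approx-below), which is what makes the μ clause a
  -- fixed point for proper bodies; being defined from lower steps only, it
  -- keeps the definition well-founded.
  approx : Ty → Env → Env → ℕ → SemTy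
  approx A ρ η zero    j M = ⊤
  approx A ρ η (suc k) j   = caseDec (j <? k) (approx A ρ η k j) (⟦ μ A ⟧ ρ η k)

_≈[_]_ : SemTy → ℕ → SemTy → Set
S ≈[ k ] S' = ∀ {j} → j ≤ k → ∀ M → S j M ⇔ S' j M

_≈<[_]_ : SemTy → ℕ → SemTy → Set
S ≈<[ k ] S' = ∀ {j} → j < k → ∀ M → S j M ⇔ S' j M

_≈ᵉ[_]_ : Env → ℕ → Env → Set
ρ ≈ᵉ[ k ] ρ' = ∀ X → ρ X ≈[ k ] ρ' X

≈-everywhere : ∀ {S S' k} → (∀ j M → S j M ⇔ S' j M) → S ≈[ k ] S'
≈-everywhere h {j} _ = h j

≈-weaken : ∀ {S S' j k} → j ≤ k → S ≈[ k ] S' → S ≈[ j ] S'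
≈-weaken j≤k h i≤j = h (≤-trans i≤j j≤k)

≈ᵉ-weaken : ∀ {ρ ρ' j k} → j ≤ k → ρ ≈ᵉ[ k ] ρ' → ρ ≈ᵉ[ j ] ρ'
≈ᵉ-weaken j≤k h X = ≈-weaken j≤k (h X)

≈ᵉ-∷ : ∀ {S S' η η' k} → S ≈[ k ] S' → η ≈ᵉ[ k ] η' → (S ∷ₑ η) ≈ᵉ[ k ] (S' ∷ₑ η')
≈ᵉ-∷ hS hη zero    = hS
≈ᵉ-∷ hS hη (suc i) = hη i

≈ᵉ-refl : ∀ {η k} → η ≈ᵉ[ k ] η
≈ᵉ-refl X _ M = ⇔.refl

Π-⇔ : ∀ {A A' B B' : Tm → Set} → (∀ N → A N ⇔ A' N) → (∀ N → B N ⇔ B' N) →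
      (∀ N → A N → B N) ⇔ (∀ N → A' N → B' N)
Π-⇔ hA hB = mk⇔ (λ f N a → to (hB N) (f N (from (hA N) a)))
                (λ f N a → from (hB N) (f N (to (hA N) a)))

⇒-cong : ∀ {A B A' B' ρ η ρ' η'} k →
         ⟦ A ⇒ B ⟧ ρ η ≈<[ k ] ⟦ A' ⇒ B' ⟧ ρ' η' →
         (∀ N → ⟦ A ⟧ ρ η k N ⇔ ⟦ A' ⟧ ρ' η' k N) →
         (∀ N → ⟦ B ⟧ ρ η k N ⇔ ⟦ B' ⟧ ρ' η' k N) →
         ∀ M → ⟦ A ⇒ B ⟧ ρ η k M ⇔ ⟦ A' ⇒ B' ⟧ ρ' η' k M
⇒-cong zero    below hA hB M = Π-⇔ hA (λ N → hB (M · N))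
⇒-cong (suc k) below hA hB M = below ≤-refl M ×-⇔ Π-⇔ hA (λ N → hB (M · N))

●-cong : ∀ {A A' ρ η ρ' η'} k → ⟦ A ⟧ ρ η ≈<[ k ] ⟦ A' ⟧ ρ' η' →
         ∀ M → ⟦ ● A ⟧ ρ η k M ⇔ ⟦ ● A' ⟧ ρ' η' k M
●-cong zero    below M = ⇔.refl
●-cong (suc k) below M = below ≤-refl M

approx-cong : ∀ {A A' ρ η ρ' η'} k → ⟦ μ A ⟧ ρ η ≈<[ k ] ⟦ μ A' ⟧ ρ' η' →
              ∀ j M → approx A ρ η k j M ⇔ approx A' ρ' η' k j M
approx-cong zero    below j M = ⇔.refl
approx-cong (suc k) below j M with j <? k
... | yes _ = approx-cong k (λ i<k → below (m<n⇒m<1+n i<k)) j M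
... | no  _ = below ≤-refl M

μ-cong : ∀ {A A' ρ η ρ' η'} k → ⟦ μ A ⟧ ρ η ≈<[ k ] ⟦ μ A' ⟧ ρ' η' →
         (approx A ρ η k ≈[ k ] approx A' ρ' η' k →
          ∀ M → ⟦ A ⟧ ρ (approx A ρ η k ∷ₑ η) k M ⇔ ⟦ A' ⟧ ρ' (approx A' ρ' η' k ∷ₑ η') k M) →
         ∀ M → ⟦ μ A ⟧ ρ η k M ⇔ ⟦ μ A' ⟧ ρ' η' k M
μ-cong zero    below body M = body (≈-everywhere (approx-cong zero below)) M
μ-cong (suc k) below body M =
  below ≤-refl M ×-⇔ body (≈-everywhere (approx-cong (suc k) below)) M

approx-below : ∀ {A ρ η k j M} → j < k → approx A ρ η k j M ⇔ ⟦ μ A ⟧ ρ η j M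
approx-below {k = suc k} {j} j<k with j <? k
... | yes j<k' = approx-below j<k'
... | no  j≮k  with ≤-antisym (≮⇒≥ j≮k) (≤-pred j<k)
...   | refl = ⇔.refl

Downward : SemTy → Set
Downward S = ∀ {k M} → S (suc k) M → S k M

DownwardEnv : Env → Set
DownwardEnv ρ = ∀ X → Downward (ρ X)

downward-∷ : ∀ {S η} → Downward S → DownwardEnv η → DownwardEnv (S ∷ₑ η)
downward-∷ dS dη zero    = dS
downward-∷ dS dη (suc i) = dη i

⟦⟧-downward : ∀ A {ρ η} → DownwardEnv ρ → DownwardEnv η → Downward (⟦ A ⟧ ρ η)
⟦⟧-downward (fv X)  dρ dη = dρ X
⟦⟧-downward (bv i)  dρ dη = dη i
⟦⟧-downward (A ⇒ B) dρ dη = proj₁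
⟦⟧-downward (● A)   dρ dη {zero}  _ = tt
⟦⟧-downward (● A)   dρ dη {suc k}   = ⟦⟧-downward A dρ dη
⟦⟧-downward (μ A)   dρ dη = proj₁

downward-≤ : ∀ {S} → Downward S → ∀ {j k M} → j ≤ k → S k M → S j M
downward-≤ d {k = zero}  z≤n x = x
downward-≤ {S} d {j} {suc k} {M} j≤k x with m≤n⇒m<n∨m≡n j≤k
... | inj₁ j<sk = downward-≤ {S} d (≤-pred j<sk) (d x)
... | inj₂ refl = x

approx-downward : ∀ {A ρ η} k → Downward (approx A ρ η k)
approx-downward zero _ = tt
approx-downward (suc k) {j} {M} x with suc j <? k | j <? k
... | yes _    | yes _   = approx-downward k {j} {M} x
... | yes sj<k | no j≮k  = ⊥-elim (j≮k (<⇒≤ sj<k))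
... | no _     | no _    = x
... | no sj≮k  | yes j<k with ≤-antisym (≮⇒≥ sj≮k) j<k
...   | refl = from (approx-below {k = suc j} {j} ≤-refl) (proj₁ x)

Full : SemTy → Set
Full S = ∀ k M → S k M

⇒-full : ∀ {A B ρ η} → Full (⟦ B ⟧ ρ η) → Full (⟦ A ⇒ B ⟧ ρ η)
⇒-full fB zero    M = λ N _ → fB zero (M · N)
⇒-full fB (suc k) M = ⇒-full fB k M , λ N _ → fB (suc k) (M · N)

●-full : ∀ {A ρ η} → Full (⟦ A ⟧ ρ η) → Full (⟦ ● A ⟧ ρ η)
●-full fA zero    M = tt
●-full fA (suc k) M = fA k M

-- A per-step property Q of predicates on terms that holds of the trivial
-- predicate and is closed under intersection passes from the body of μA to
-- μA: by induction on the step it holds of μA and of all approximations.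
μ-preserves : ∀ (Q : (Tm → Set) → Set) {A ρ η} →
              Q (λ _ → ⊤) → (∀ {P P'} → Q P → Q P' → Q (λ M → P M × P' M)) →
              (∀ {S} → (∀ k → Q (S k)) → ∀ k → Q (⟦ A ⟧ ρ (S ∷ₑ η) k)) →
              ∀ k → Q (⟦ μ A ⟧ ρ η k)
μ-preserves Q {A} {ρ} {η} q⊤ q× body k = proj₁ (upTo k)
  where
  upTo : ∀ k → Q (⟦ μ A ⟧ ρ η k) × (∀ j → Q (approx A ρ η k j))
  upTo zero    = body {approx A ρ η zero} (λ _ → q⊤) zero , (λ _ → q⊤)
  upTo (suc k) = q× (proj₁ (upTo k)) (body qApprox (suc k)) , qApprox
    where
    qApprox : ∀ j → Q (approx A ρ η (suc k) j)
    qApprox j with j <? k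
    ... | yes _ = proj₂ (upTo k) j
    ... | no  _ = proj₁ (upTo k)

μ-full : ∀ {A ρ η} → (∀ {S} → Full S → Full (⟦ A ⟧ ρ (S ∷ₑ η))) → Full (⟦ μ A ⟧ ρ η)
μ-full = μ-preserves (λ P → ∀ M → P M) (λ _ → tt) (λ p p' M → p M , p' M)

guarded⇒plain : ∀ {j A} → Guarded j A → Plain j A
guarded⇒plain (gd-● p) = pl-● p
guarded⇒plain (gd-μ g) = pl-μ (guarded⇒plain g)

plain-full : ∀ B j {ρ η} → Plain j (tail B) → Full (η j) → Full (⟦ B ⟧ ρ η)
plain-full (fv X)  j ()       h
plain-full (bv i)  j pl-var   h = h
plain-full (A ⇒ B) j p        h = ⇒-full (plain-full B j p h)
plain-full (● B)   j (pl-● p) h = ●-full (plain-full B j p h)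
plain-full (μ B)   j (pl-μ p) h = μ-full (λ _ → plain-full B (suc j) p h)

topVariant-full : ∀ B {ρ η} → TopVariant B → Full (⟦ B ⟧ ρ η)
topVariant-full (fv X)  ()
topVariant-full (bv i)  ()
topVariant-full (A ⇒ B) t          = ⇒-full (topVariant-full B t)
topVariant-full (● B)   (ts-● t)   = ●-full (topVariant-full B t)
topVariant-full (μ B)   (ts-μ t)   = μ-full (λ _ → topVariant-full B t)
topVariant-full (μ B)   (ts-hit g) = μ-full (plain-full B 0 (guarded⇒plain g))

Top-full : ∀ {ρ η} → Full (⟦ Top ⟧ ρ η)
Top-full = topVariant-full Top (ts-hit (gd-● pl-var))

AllFV : (ℕ → Set) → Ty → Set
AllFV P (fv X)  = P X
AllFV P (bv i)  = ⊤
AllFV P (A ⇒ B) = AllFV P A × AllFV P B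
AllFV P (● A)   = AllFV P A
AllFV P (μ A)   = AllFV P A

AllFV-⊤ : ∀ A → AllFV (λ _ → ⊤) A
AllFV-⊤ (fv X)  = tt
AllFV-⊤ (bv i)  = tt
AllFV-⊤ (A ⇒ B) = AllFV-⊤ A , AllFV-⊤ B
AllFV-⊤ (● A)   = AllFV-⊤ A
AllFV-⊤ (μ A)   = AllFV-⊤ A

∉FV⇒AllFV : ∀ {X} A → X ∉FV A → AllFV (X ≢_) A
∉FV⇒AllFV (fv Y)  fr          = fr
∉FV⇒AllFV (bv i)  fr          = tt
∉FV⇒AllFV (A ⇒ B) (frA , frB) = ∉FV⇒AllFV A frA , ∉FV⇒AllFV B frB
∉FV⇒AllFV (● A)   fr          = ∉FV⇒AllFV A fr
∉FV⇒AllFV (μ A)   fr          = ∉FV⇒AllFV A fr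

Local : ℕ → Set₁
Local k = ∀ A P {ρ ρ' η η'} → AllFV P A → (∀ X → P X → ρ X ≈[ k ] ρ' X) → η ≈ᵉ[ k ] η' →
          ∀ M → ⟦ A ⟧ ρ η k M ⇔ ⟦ A ⟧ ρ' η' k M

⟦⟧-local : ∀ k → Local k
⟦⟧-local = <-rec Local step
  where
  lower : ∀ {P : ℕ → Set} {ρ ρ' : Env} {j k} → j < k →
          (∀ X → P X → ρ X ≈[ k ] ρ' X) → ∀ X → P X → ρ X ≈[ j ] ρ' X
  lower j<k hρ X p = ≈-weaken (<⇒≤ j<k) (hρ X p)

  step : ∀ k → (∀ {j} → j < k → Local j) → Local k
  step k IH (fv X)  P a         hρ hη M = hρ X a ≤-refl M
  step k IH (bv i)  P a         hρ hη M = hη i ≤-refl M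
  step k IH (A ⇒ B) P (aA , aB) hρ hη   =
    ⇒-cong k (λ j<k → IH j<k (A ⇒ B) P (aA , aB) (lower j<k hρ) (≈ᵉ-weaken (<⇒≤ j<k) hη))
           (step k IH A P aA hρ hη) (step k IH B P aB hρ hη)
  step k IH (● A)   P a         hρ hη   =
    ●-cong k (λ j<k → IH j<k A P a (lower j<k hρ) (≈ᵉ-weaken (<⇒≤ j<k) hη))
  step k IH (μ A)   P a         hρ hη   =
    μ-cong k (λ j<k → IH j<k (μ A) P a (lower j<k hρ) (≈ᵉ-weaken (<⇒≤ j<k) hη))
           (λ hS → step k IH A P a hρ (≈ᵉ-∷ hS hη))

⟦⟧-nonexpansive : ∀ k A {ρ ρ' η η'} → ρ ≈ᵉ[ k ] ρ' → η ≈ᵉ[ k ] η' →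
                  ∀ M → ⟦ A ⟧ ρ η k M ⇔ ⟦ A ⟧ ρ' η' k M
⟦⟧-nonexpansive k A hρ = ⟦⟧-local k A (λ _ → ⊤) (AllFV-⊤ A) (λ X _ → hρ X)

update : Env → ℕ → SemTy → Env
update ρ X S Y = if X ≡ᵇ Y then S else ρ Y

update-same : ∀ ρ X S → update ρ X S X ≡ S
update-same ρ X S rewrite to T-≡ (≡⇒≡ᵇ X X refl) = refl

update-other : ∀ ρ {X} S {Y} → X ≢ Y → update ρ X S Y ≡ ρ Y
update-other ρ {X} S {Y} X≢Y rewrite ¬-not (λ e → X≢Y (≡ᵇ⇒≡ X Y (from T-≡ e))) = refl

≡⇒⇔ : ∀ {S S' : SemTy} → S ≡ S' → ∀ j M → S j M ⇔ S' j M
≡⇒⇔ refl j M = ⇔.refl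

update-agree-off : ∀ ρ {X} S S' {Y k} → X ≢ Y → update ρ X S Y ≈[ k ] update ρ X S' Y
update-agree-off ρ S S' X≢Y rewrite update-other ρ S X≢Y | update-other ρ S' X≢Y = λ _ M → ⇔.refl

update-agree-at : ∀ ρ X {S S' k} → S ≈<[ k ] S' → update ρ X S X ≈<[ k ] update ρ X S' X
update-agree-at ρ X {S} {S'} h rewrite update-same ρ X S | update-same ρ X S' = h

⟦⟧-fresh : ∀ A X {S ρ η} → X ∉FV A → ∀ k M → ⟦ A ⟧ (update ρ X S) η k M ⇔ ⟦ A ⟧ ρ η k M
⟦⟧-fresh A X {S} {ρ} fr k =
  ⟦⟧-local k A (X ≢_) (∉FV⇒AllFV A fr)
            (λ Y X≢Y → ≈-everywhere (≡⇒⇔ (update-other ρ S X≢Y))) ≈ᵉ-refl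

-- Guarded occurrences of X are read at a lower
-- step, and unguarded ones lie in ⊤-variants, which are full.
⟦⟧-contractive : ∀ k X {ρ ρ'} → (∀ Y → X ≢ Y → ρ Y ≈[ k ] ρ' Y) → ρ X ≈<[ k ] ρ' X →
                 ∀ A {η η'} → Proper X A → η ≈ᵉ[ k ] η' →
                 ∀ M → ⟦ A ⟧ ρ η k M ⇔ ⟦ A ⟧ ρ' η' k M
⟦⟧-contractive k X {ρ} {ρ'} hY hX = go
  where
  agreeBelow : ∀ {j} → j < k → ρ ≈ᵉ[ j ] ρ'
  agreeBelow j<k Y with X ≟ Y
  ... | yes refl = λ i≤j → hX (≤-<-trans i≤j j<k)
  ... | no  X≢Y  = ≈-weaken (<⇒≤ j<k) (hY Y X≢Y)

  below : ∀ A {η η'} → η ≈ᵉ[ k ] η' → ⟦ A ⟧ ρ η ≈<[ k ] ⟦ A ⟧ ρ' η'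
  below A hη j<k = ⟦⟧-nonexpansive _ A (agreeBelow j<k) (≈ᵉ-weaken (<⇒≤ j<k) hη)

  bothFull : ∀ A {η η'} → TopVariant A → ∀ M → ⟦ A ⟧ ρ η k M ⇔ ⟦ A ⟧ ρ' η' k M
  bothFull A tv M = mk⇔ (λ _ → topVariant-full A tv k M) (λ _ → topVariant-full A tv k M)

  go : ∀ A {η η'} → Proper X A → η ≈ᵉ[ k ] η' → ∀ M → ⟦ A ⟧ ρ η k M ⇔ ⟦ A ⟧ ρ' η' k M
  go (fv Y)  X≢Y              hη M = hY Y X≢Y ≤-refl M
  go (bv i)  _                hη M = hη i ≤-refl M
  go (A ⇒ B) (inj₂ tv)        hη   = bothFull (A ⇒ B) tv
  go (A ⇒ B) (inj₁ (pA , pB)) hη   = ⇒-cong k (below (A ⇒ B) hη) (go A pA hη) (go B pB hη)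
  go (● A)   _                hη   = ●-cong k (below A hη)
  go (μ A)   (inj₂ tv)        hη   = bothFull (μ A) tv
  go (μ A)   (inj₁ p)         hη   = μ-cong k (below (μ A) hη) (λ hS → go A p (≈ᵉ-∷ hS hη))

updateIx : Env → ℕ → SemTy → Env
updateIx η n S i = if i ≡ᵇ n then S else η i

Opening : ℕ → Set₁
Opening k = ∀ A n U S ρ η → (∀ η' j M → ⟦ U ⟧ ρ η' j M ⇔ S j M) →
            ∀ M → ⟦ openRec n U A ⟧ ρ η k M ⇔ ⟦ A ⟧ ρ (updateIx η n S) k M

⟦⟧-open : ∀ k → Opening k
⟦⟧-open = <-rec Opening step
  where
  step : ∀ k → (∀ {j} → j < k → Opening j) → Opening k
  step k IH (fv X)  n U S ρ η hU M = ⇔.refl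
  step k IH (bv i)  n U S ρ η hU M with i ≡ᵇ n
  ... | true  = hU η k M
  ... | false = ⇔.refl
  step k IH (A ⇒ B) n U S ρ η hU = ⇒-cong k (λ j<k → IH j<k (A ⇒ B) n U S ρ η hU)
                                     (step k IH A n U S ρ η hU) (step k IH B n U S ρ η hU)
  step k IH (● A)   n U S ρ η hU = ●-cong k (λ j<k → IH j<k A n U S ρ η hU)
  step k IH (μ A)   n U S ρ η hU = μ-cong k (λ j<k → IH j<k (μ A) n U S ρ η hU) body
    where
    A' : Ty
    A' = openRec (suc n) U A
    body : approx A' ρ η k ≈[ k ] approx A ρ (updateIx η n S) k →
           ∀ M → ⟦ A' ⟧ ρ (approx A' ρ η k ∷ₑ η) k M ⇔
                 ⟦ A ⟧ ρ (approx A ρ (updateIx η n S) k ∷ₑ updateIx η n S) k M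
    body hS M = ⇔.trans (step k IH A (suc n) U S ρ _ hU M) (⟦⟧-nonexpansive k A ≈ᵉ-refl agree M)
      where
      agree : updateIx (approx A' ρ η k ∷ₑ η) (suc n) S ≈ᵉ[ k ]
              (approx A ρ (updateIx η n S) k ∷ₑ updateIx η n S)
      agree zero    = hS
      agree (suc i) = λ _ M → ⇔.refl

Closing : ℕ → Set₁
Closing k = ∀ A n X ρ η M → ⟦ closeRec n X A ⟧ ρ η k M ⇔ ⟦ A ⟧ (update ρ X (η n)) η k M

⟦⟧-close : ∀ k → Closing k
⟦⟧-close = <-rec Closing step
  where
  step : ∀ k → (∀ {j} → j < k → Closing j) → Closing k
  step k IH (fv Y)  n X ρ η M with X ≡ᵇ Y
  ... | true  = ⇔.refl
  ... | false = ⇔.refl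
  step k IH (bv i)  n X ρ η M = ⇔.refl
  step k IH (A ⇒ B) n X ρ η = ⇒-cong k (λ j<k → IH j<k (A ⇒ B) n X ρ η)
                                (step k IH A n X ρ η) (step k IH B n X ρ η)
  step k IH (● A)   n X ρ η = ●-cong k (λ j<k → IH j<k A n X ρ η)
  step k IH (μ A)   n X ρ η = μ-cong k (λ j<k → IH j<k (μ A) n X ρ η)
    (λ hS M → ⇔.trans (step k IH A (suc n) X ρ _ M) (⟦⟧-nonexpansive k A ≈ᵉ-refl (≈ᵉ-∷ hS ≈ᵉ-refl) M))

Substitution : ℕ → Set₁
Substitution k = ∀ A X U S ρ η → DownwardEnv η →
                 (∀ η' → DownwardEnv η' → ∀ j M → ⟦ U ⟧ ρ η' j M ⇔ S j M) →
                 ∀ M → ⟦ substT X U A ⟧ ρ η k M ⇔ ⟦ A ⟧ (update ρ X S) η k M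

⟦⟧-subst : ∀ k → Substitution k
⟦⟧-subst = <-rec Substitution step
  where
  step : ∀ k → (∀ {j} → j < k → Substitution j) → Substitution k
  step k IH (fv Y)  X U S ρ η dη hU M with X ≡ᵇ Y
  ... | true  = hU η dη k M
  ... | false = ⇔.refl
  step k IH (bv i)  X U S ρ η dη hU M = ⇔.refl
  step k IH (A ⇒ B) X U S ρ η dη hU = ⇒-cong k (λ j<k → IH j<k (A ⇒ B) X U S ρ η dη hU)
                                        (step k IH A X U S ρ η dη hU) (step k IH B X U S ρ η dη hU)
  step k IH (● A)   X U S ρ η dη hU = ●-cong k (λ j<k → IH j<k A X U S ρ η dη hU)
  step k IH (μ A)   X U S ρ η dη hU = μ-cong k (λ j<k → IH j<k (μ A) X U S ρ η dη hU)
    (λ hS M → ⇔.trans (step k IH A X U S ρ _ (downward-∷ (approx-downward k) dη) hU M)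
                      (⟦⟧-nonexpansive k A ≈ᵉ-refl (≈ᵉ-∷ hS ≈ᵉ-refl) M))

⟦⟧-open-fresh : ∀ A X {S T ρ η} → X ∉FV A →
                ∀ k M → ⟦ A ⟧ ρ (S ∷ₑ η) k M ⇔ ⟦ openT A (fv X) ⟧ (update ρ X S) (T ∷ₑ η) k M
⟦⟧-open-fresh A X {S} {T} {ρ} {η} fr k M = ⇔.sym (⇔.trans opened (⇔.trans reindexed (⟦⟧-fresh A X fr k M)))
  where
  opened : ⟦ openT A (fv X) ⟧ (update ρ X S) (T ∷ₑ η) k M ⇔
           ⟦ A ⟧ (update ρ X S) (updateIx (T ∷ₑ η) 0 S) k M
  opened = ⟦⟧-open k A 0 (fv X) S (update ρ X S) (T ∷ₑ η) (λ _ → ≡⇒⇔ (update-same ρ X S)) M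
  reindexed : ⟦ A ⟧ (update ρ X S) (updateIx (T ∷ₑ η) 0 S) k M ⇔ ⟦ A ⟧ (update ρ X S) (S ∷ₑ η) k M
  reindexed = ⟦⟧-nonexpansive k A ≈ᵉ-refl (λ { zero → λ _ M → ⇔.refl ; (suc i) → λ _ M → ⇔.refl }) M

body-contractive : ∀ A X {ρ η S S' k} → X ∉FV A → Proper X (openT A (fv X)) → S ≈<[ k ] S' →
                   ∀ M → ⟦ A ⟧ ρ (S ∷ₑ η) k M ⇔ ⟦ A ⟧ ρ (S' ∷ₑ η) k M
body-contractive A X {ρ} {η} {S} {S'} {k} fr pr h M =
  ⇔.trans (⟦⟧-open-fresh A X {S} {S} fr k M)
  (⇔.trans (⟦⟧-contractive k X (λ Y → update-agree-off ρ S S') (update-agree-at ρ X h)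
                           (openT A (fv X)) pr ≈ᵉ-refl M)
           (⇔.sym (⟦⟧-open-fresh A X {S'} {S} fr k M)))

-- Well-formed type expressions have no dangling indices, so their
-- interpretation ignores the valuation of bound indices.
WFClosed : ℕ → Set₁
WFClosed k = ∀ A → WF A → ∀ ρ η η' M → ⟦ A ⟧ ρ η k M ⇔ ⟦ A ⟧ ρ η' k M

⟦⟧-wf-closed : ∀ k → WFClosed k
⟦⟧-wf-closed = <-rec WFClosed step
  where
  step : ∀ k → (∀ {j} → j < k → WFClosed j) → WFClosed k
  step k IH (fv X)  wf-fv         ρ η η' M = ⇔.refl
  step k IH (A ⇒ B) (wf-⇒ wA wB)  ρ η η'   = ⇒-cong k (λ j<k → IH j<k (A ⇒ B) (wf-⇒ wA wB) ρ η η')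
                                               (step k IH A wA ρ η η') (step k IH B wB ρ η η')
  step k IH (● A)   (wf-● w)      ρ η η'   = ●-cong k (λ j<k → IH j<k A w ρ η η')
  step k IH (μ A) w@(wf-μ X fr pr wb) ρ η η' = μ-cong k (λ j<k → IH j<k (μ A) w ρ η η') body
    where
    S S' : SemTy
    S  = approx A ρ η k
    S' = approx A ρ η' k
    body : S ≈[ k ] S' → ∀ M → ⟦ A ⟧ ρ (S ∷ₑ η) k M ⇔ ⟦ A ⟧ ρ (S' ∷ₑ η') k M
    body hS M =
      ⇔.trans (⟦⟧-open-fresh A X {S} {S} fr k M)
      (⇔.trans (step k IH (openT A (fv X)) wb (update ρ X S) (S ∷ₑ η) (S ∷ₑ η') M)
      (⇔.trans (⇔.sym (⟦⟧-open-fresh A X {S} {S} fr k M))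
               (⟦⟧-nonexpansive k A ≈ᵉ-refl (≈ᵉ-∷ hS ≈ᵉ-refl) M)))

-- Part 3.  Soundness of type equality, subtyping and typing.

⇒-cong-all : ∀ {A B A' B' ρ η ρ' η'} →
             (∀ k N → ⟦ A ⟧ ρ η k N ⇔ ⟦ A' ⟧ ρ' η' k N) →
             (∀ k N → ⟦ B ⟧ ρ η k N ⇔ ⟦ B' ⟧ ρ' η' k N) →
             ∀ k M → ⟦ A ⇒ B ⟧ ρ η k M ⇔ ⟦ A' ⇒ B' ⟧ ρ' η' k M
⇒-cong-all hA hB = <-rec _ (λ k below → ⇒-cong k below (hA k) (hB k))

●-cong-all : ∀ {A A' ρ η ρ' η'} → (∀ k N → ⟦ A ⟧ ρ η k N ⇔ ⟦ A' ⟧ ρ' η' k N) →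
             ∀ k M → ⟦ ● A ⟧ ρ η k M ⇔ ⟦ ● A' ⟧ ρ' η' k M
●-cong-all hA k = ●-cong k (λ {j} _ → hA j)

μ-unique : ∀ {A ρ η} (S : SemTy) → Downward S →
           (∀ k → S ≈<[ k ] ⟦ μ A ⟧ ρ η → ∀ M → S k M ⇔ ⟦ A ⟧ ρ (approx A ρ η k ∷ₑ η) k M) →
           ∀ k M → S k M ⇔ ⟦ μ A ⟧ ρ η k M
μ-unique S dS unfold = <-rec _ step
  where
  step : ∀ k → S ≈<[ k ] _ → ∀ M → S k M ⇔ _
  step zero    below M = unfold zero below M
  step (suc k) below M = mk⇔ (λ s → to (below ≤-refl M) (dS s) , to (unfold (suc k) below M) s)
                             (λ { (_ , b) → from (unfold (suc k) below M) b })

-- Soundness of type equality: equal types have equal interpretations at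
-- downward closed valuations, and (as a by-product of the induction) their
-- interpretations ignore the bound indices.
SemEq : Ty → Ty → Set₁
SemEq A B = ∀ ρ η → DownwardEnv ρ → DownwardEnv η → ∀ k M → ⟦ A ⟧ ρ η k M ⇔ ⟦ B ⟧ ρ η k M

IxFree : Ty → Set₁
IxFree A = ∀ ρ η η' → DownwardEnv ρ → DownwardEnv η → DownwardEnv η' →
           ∀ k M → ⟦ A ⟧ ρ η k M ⇔ ⟦ A ⟧ ρ η' k M

WF⇒IxFree : ∀ {A} → WF A → IxFree A
WF⇒IxFree {A} w ρ η η' _ _ _ k = ⟦⟧-wf-closed k A w ρ η η'

⟦⟧-fold : ∀ A → WF (μ A) → WF (openT A (μ A)) → SemEq (μ A) (openT A (μ A))
⟦⟧-fold A w@(wf-μ X fr pr _) w' ρ η dρ dη k M =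
  ⇔.sym (μ-unique (⟦ openT A (μ A) ⟧ ρ η) (⟦⟧-downward (openT A (μ A)) dρ dη) unfold k M)
  where
  Sμ : SemTy
  Sμ = ⟦ μ A ⟧ ρ η
  unfold : ∀ k → ⟦ openT A (μ A) ⟧ ρ η ≈<[ k ] Sμ →
           ∀ M → ⟦ openT A (μ A) ⟧ ρ η k M ⇔ ⟦ A ⟧ ρ (approx A ρ η k ∷ₑ η) k M
  unfold k _ M =
    ⇔.trans (⟦⟧-wf-closed k (openT A (μ A)) w' ρ η (Sμ ∷ₑ η) M)
    (⇔.trans (⟦⟧-open k A 0 (μ A) Sμ ρ (Sμ ∷ₑ η) (λ η' j → ⟦⟧-wf-closed j (μ A) w ρ η' η) M)
    (⇔.trans (⟦⟧-nonexpansive k A ≈ᵉ-refl (λ { zero → λ _ M → ⇔.refl ; (suc i) → λ _ M → ⇔.refl }) M)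
             (body-contractive A X fr pr (λ j<k M → ⇔.sym (approx-below j<k)) M)))

⟦⟧-unique : ∀ A C X → WF C → Proper X C → SemEq A (substT X A C) → IxFree A → SemEq A (μ (closeT X C))
⟦⟧-unique A C X wC pr eq ixA ρ η dρ dη = μ-unique SA (⟦⟧-downward A dρ dη) unfold
  where
  SA : SemTy
  SA = ⟦ A ⟧ ρ η
  C' : Ty
  C' = closeT X C
  unfold : ∀ k → SA ≈<[ k ] ⟦ μ C' ⟧ ρ η → ∀ M → SA k M ⇔ ⟦ C' ⟧ ρ (approx C' ρ η k ∷ₑ η) k M
  unfold k below M = ⇔.sym (
    ⇔.trans (⟦⟧-close k C 0 X ρ (L ∷ₑ η) M)
    (⇔.trans (⟦⟧-wf-closed k C wC (update ρ X L) (L ∷ₑ η) η M)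
    (⇔.trans (⟦⟧-contractive k X (λ Y → update-agree-off ρ L SA) (update-agree-at ρ X L≈SA) C pr ≈ᵉ-refl M)
    (⇔.trans (⇔.sym (⟦⟧-subst k C X A SA ρ η dη (λ η' dη' → ixA ρ η' η dρ dη' dη) M))
             (⇔.sym (eq ρ η dρ dη k M))))))
    where
    L : SemTy
    L = approx C' ρ η k
    L≈SA : L ≈<[ k ] SA
    L≈SA j<k M = ⇔.trans (approx-below j<k) (⇔.sym (below j<k M))

⟦⟧-●⇒ : ∀ A B ρ η k M → ⟦ ● (A ⇒ B) ⟧ ρ η k M ⇔ ⟦ ● A ⇒ ● B ⟧ ρ η k M
⟦⟧-●⇒ A B ρ η zero          M = mk⇔ (λ _ N _ → tt) (λ _ → tt)
⟦⟧-●⇒ A B ρ η (suc zero)    M = mk⇔ (λ f → (λ N _ → tt) , f) proj₂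
⟦⟧-●⇒ A B ρ η (suc (suc k)) M = ⟦⟧-●⇒ A B ρ η (suc k) M ×-⇔ ⇔.refl

WF-Top : WF Top
WF-Top = wf-μ 0 tt tt (wf-● wf-fv)

≃-sound : ∀ {A B} → A ≃ B → SemEq A B × IxFree A × IxFree B
≃-sound (≃-refl w) = (λ _ _ _ _ _ _ → ⇔.refl) , WF⇒IxFree w , WF⇒IxFree w
≃-sound (≃-sym d) with ≃-sound d
... | eq , ixA , ixB = (λ ρ η dρ dη k M → ⇔.sym (eq ρ η dρ dη k M)) , ixB , ixA
≃-sound (≃-trans d d') with ≃-sound d | ≃-sound d'
... | eq , ixA , _ | eq' , _ , ixC =
  (λ ρ η dρ dη k M → ⇔.trans (eq ρ η dρ dη k M) (eq' ρ η dρ dη k M)) , ixA , ixC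
≃-sound (≃-● d) with ≃-sound d
... | eq , ixA , ixB =
  (λ ρ η dρ dη → ●-cong-all (eq ρ η dρ dη)) ,
  (λ ρ η η' dρ dη dη' → ●-cong-all (ixA ρ η η' dρ dη dη')) ,
  (λ ρ η η' dρ dη dη' → ●-cong-all (ixB ρ η η' dρ dη dη'))
≃-sound (≃-⇒ d d') with ≃-sound d | ≃-sound d'
... | eq , ixA , ixA' | eq' , ixB , ixB' =
  (λ ρ η dρ dη → ⇒-cong-all (eq ρ η dρ dη) (eq' ρ η dρ dη)) ,
  (λ ρ η η' dρ dη dη' → ⇒-cong-all (ixA ρ η η' dρ dη dη') (ixB ρ η η' dρ dη dη')) ,
  (λ ρ η η' dρ dη dη' → ⇒-cong-all (ixA' ρ η η' dρ dη dη') (ixB' ρ η η' dρ dη dη'))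
≃-sound {A ⇒ _} (≃-⊤ w) =
  (λ ρ η _ _ k M → mk⇔ (λ _ → Top-full k M) (λ _ → topVariant-full (A ⇒ Top) (ts-hit (gd-● pl-var)) k M)) ,
  WF⇒IxFree (wf-⇒ w WF-Top) , WF⇒IxFree WF-Top
≃-sound {μ A} (≃-fold w w') = ⟦⟧-fold A w w' , WF⇒IxFree w , WF⇒IxFree w'
≃-sound {A} (≃-uniq {C = C} X wC pr d) with ≃-sound d
... | eq , ixA , _ = eqμ , ixA , ixμ
  where
  eqμ : SemEq A (μ (closeT X C))
  eqμ = ⟦⟧-unique A C X wC pr eq ixA
  ixμ : IxFree (μ (closeT X C))
  ixμ ρ η η' dρ dη dη' k M =
    ⇔.trans (⇔.sym (eqμ ρ η dρ dη k M)) (⇔.trans (ixA ρ η η' dρ dη dη' k M) (eqμ ρ η' dρ dη' k M))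
≃-sound (≃-●⇒ {A} {B} wA wB) =
  (λ ρ η _ _ → ⟦⟧-●⇒ A B ρ η) ,
  WF⇒IxFree (wf-● (wf-⇒ wA wB)) , WF⇒IxFree (wf-⇒ (wf-● wA) (wf-● wB))

⇒-unfold : ∀ A B ρ η k M → ⟦ A ⇒ B ⟧ ρ η k M ⇔
           (∀ {j} → j ≤ k → ∀ N → ⟦ A ⟧ ρ η j N → ⟦ B ⟧ ρ η j (M · N))
⇒-unfold A B ρ η zero    M = mk⇔ (λ { f z≤n → f }) (λ f → f z≤n)
⇒-unfold A B ρ η (suc k) M = mk⇔ to′ from′
  where
  to′ : ⟦ A ⇒ B ⟧ ρ η (suc k) M →
        ∀ {j} → j ≤ suc k → ∀ N → ⟦ A ⟧ ρ η j N → ⟦ B ⟧ ρ η j (M · N)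
  to′ (f , g) j≤sk with m≤n⇒m<n∨m≡n j≤sk
  ... | inj₁ j<sk = to (⇒-unfold A B ρ η k M) f (≤-pred j<sk)
  ... | inj₂ refl = g
  from′ : (∀ {j} → j ≤ suc k → ∀ N → ⟦ A ⟧ ρ η j N → ⟦ B ⟧ ρ η j (M · N)) →
          ⟦ A ⇒ B ⟧ ρ η (suc k) M
  from′ f = from (⇒-unfold A B ρ η k M) (λ j≤k → f (m≤n⇒m≤1+n j≤k)) , f ≤-refl

Sat : Asm → Env → ℕ → Set
Sat γ ρ k = ∀ {X Y} → (X , Y) ∈ γ → ∀ {j} → j ≤ k → ∀ M → ρ X j M → ρ Y j M

Sat-weaken : ∀ {γ ρ j k} → j ≤ k → Sat γ ρ k → Sat γ ρ j
Sat-weaken j≤k sat p i≤j = sat p (≤-trans i≤j j≤k)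

Sat-⊆ : ∀ {γ δ ρ k} → (∀ {p} → p ∈ δ → p ∈ γ) → Sat γ ρ k → Sat δ ρ k
Sat-⊆ δ⊆γ sat p = sat (δ⊆γ p)

SemSub : Asm → Ty → Ty → Set₁
SemSub γ A B = ∀ ρ η → DownwardEnv ρ → DownwardEnv η → ∀ k → Sat γ ρ k →
               ∀ M → ⟦ A ⟧ ρ η k M → ⟦ B ⟧ ρ η k M

approx-mono : ∀ {A B ρ η} k → (∀ {j} → j < k → ∀ M → ⟦ μ A ⟧ ρ η j M → ⟦ μ B ⟧ ρ η j M) →
              ∀ j M → approx A ρ η k j M → approx B ρ η k j M
approx-mono zero    below j M _ = tt
approx-mono (suc k) below j M with j <? k
... | yes _ = approx-mono k (λ i<k → below (m<n⇒m<1+n i<k)) j M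
... | no  _ = below ≤-refl M

∉FV-open : ∀ A n X {Y} → Y ∉FV A → Y ≢ X → Y ∉FV openRec n (fv X) A
∉FV-open (fv Z)  n X fr         Y≢X = fr
∉FV-open (bv i)  n X fr         Y≢X with i ≡ᵇ n
... | true  = Y≢X
... | false = tt
∉FV-open (A ⇒ B) n X (frA , frB) Y≢X = ∉FV-open A n X frA Y≢X , ∉FV-open B n X frB Y≢X
∉FV-open (● A)   n X fr         Y≢X = ∉FV-open A n X fr Y≢X
∉FV-open (μ A)   n X fr         Y≢X = ∉FV-open A (suc n) X fr Y≢X

update-update-other : ∀ ρ {X} S Y T {Z} → X ≢ Z → update (update ρ X S) Y T Z ≡ update ρ Y T Z
update-update-other ρ {X} S Y T {Z} X≢Z with Y ≟ Z
... | yes refl = trans (update-same (update ρ X S) Y T) (sym (update-same ρ Y T))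
... | no  Y≢Z  = trans (update-other (update ρ X S) T Y≢Z)
                       (trans (update-other ρ S X≢Z) (sym (update-other ρ T Y≢Z)))

downward-update : ∀ {ρ} X {S} → DownwardEnv ρ → Downward S → DownwardEnv (update ρ X S)
downward-update X dρ dS Y with X ≡ᵇ Y
... | true  = dS
... | false = dρ Y

-- By induction on the step: valuing X and Y by the
-- approximations of μA and μB satisfies the extra assumption X ≼ Y up to
-- step k, since the approximations only involve steps below k.
μ-sound : ∀ {γ γ' A B} (X Y : ℕ) → X ≢ Y → X ∉γ γ → Y ∉γ γ →
          X ∉FV A → X ∉FV B → Y ∉FV A → Y ∉FV B → γ' ≐ ((X , Y) ∷ γ) →
          SemSub γ' (openT A (fv X)) (openT B (fv Y)) → SemSub γ (μ A) (μ B)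
μ-sound {γ} {γ'} {A} {B} X Y X≢Y Xγ Yγ fXA fXB fYA fYB γ'≐ bodies ρ η dρ dη =
  <-rec (λ k → Sat γ ρ k → ∀ M → ⟦ μ A ⟧ ρ η k M → ⟦ μ B ⟧ ρ η k M) step
  where
  Y≢X : Y ≢ X
  Y≢X e = X≢Y (sym e)

  unfolded : ∀ k → (∀ {j} → j < k → Sat γ ρ j → ∀ M → ⟦ μ A ⟧ ρ η j M → ⟦ μ B ⟧ ρ η j M) →
             Sat γ ρ k →
             ∀ M → ⟦ A ⟧ ρ (approx A ρ η k ∷ₑ η) k M → ⟦ B ⟧ ρ (approx B ρ η k ∷ₑ η) k M
  unfolded k IH sat M a = from (⟦⟧-open-fresh B Y {TB} {TA} fYB k M) (to dropX b)
    where
    TA TB : SemTy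
    TA = approx A ρ η k
    TB = approx B ρ η k
    ρ' : Env
    ρ' = update (update ρ X TA) Y TB

    ρ'-X : ρ' X ≡ TA
    ρ'-X = trans (update-other (update ρ X TA) TB Y≢X) (update-same ρ X TA)
    ρ'-other : ∀ {V} → X ≢ V → Y ≢ V → ρ' V ≡ ρ V
    ρ'-other X≢V Y≢V = trans (update-other (update ρ X TA) TB Y≢V) (update-other ρ TA X≢V)

    sat' : Sat γ' ρ' k
    sat' mem j≤k N x with proj₁ γ'≐ mem
    ... | here refl = from (≡⇒⇔ (update-same (update ρ X TA) Y TB) _ N)
        (approx-mono k (λ i<k → IH i<k (Sat-weaken (<⇒≤ i<k) sat)) _ N (to (≡⇒⇔ ρ'-X _ N) x))
    ... | there q = from (≡⇒⇔ (ρ'-other (λ e → Xγ q (inj₂ e)) (λ e → Yγ q (inj₂ e))) _ N)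
        (sat q j≤k N (to (≡⇒⇔ (ρ'-other (λ e → Xγ q (inj₁ e)) (λ e → Yγ q (inj₁ e))) _ N) x))

    a' : ⟦ openT A (fv X) ⟧ ρ' (TA ∷ₑ η) k M
    a' = from (⟦⟧-fresh (openT A (fv X)) Y (∉FV-open A 0 X fYA Y≢X) k M) (to (⟦⟧-open-fresh A X fXA k M) a)

    b : ⟦ openT B (fv Y) ⟧ ρ' (TA ∷ₑ η) k M
    b = bodies ρ' (TA ∷ₑ η) (downward-update Y (downward-update X dρ (approx-downward k)) (approx-downward k))
               (downward-∷ (approx-downward k) dη) k sat' M a'

    dropX : ⟦ openT B (fv Y) ⟧ ρ' (TA ∷ₑ η) k M ⇔ ⟦ openT B (fv Y) ⟧ (update ρ Y TB) (TA ∷ₑ η) k M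
    dropX = ⟦⟧-local k (openT B (fv Y)) (X ≢_) (∉FV⇒AllFV (openT B (fv Y)) (∉FV-open B 0 Y fXB X≢Y))
                     (λ Z X≢Z → ≈-everywhere (≡⇒⇔ (update-update-other ρ TA Y TB X≢Z))) ≈ᵉ-refl M

  step : ∀ k → (∀ {j} → j < k → Sat γ ρ j → ∀ M → ⟦ μ A ⟧ ρ η j M → ⟦ μ B ⟧ ρ η j M) →
         Sat γ ρ k → ∀ M → ⟦ μ A ⟧ ρ η k M → ⟦ μ B ⟧ ρ η k M
  step zero    IH sat M a        = unfolded zero IH sat M a
  step (suc k) IH sat M (a₀ , a) =
    IH ≤-refl (Sat-weaken (m≤n⇒m≤1+n ≤-refl) sat) M a₀ , unfolded (suc k) IH sat M a

Sat-split : ∀ {γ γ₁ γ₂ ρ k} → γ ≐ (γ₁ ++ γ₂) → Sat γ ρ k → Sat γ₁ ρ k × Sat γ₂ ρ k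
Sat-split {γ₁ = γ₁} γ≐ sat =
  Sat-⊆ (λ p → proj₂ γ≐ (∈-++⁺ˡ p)) sat , Sat-⊆ (λ p → proj₂ γ≐ (∈-++⁺ʳ γ₁ p)) sat

≼-sound : ∀ {γ A B} → γ ⊢ A ≼ B → SemSub γ A B
≼-sound (≼-hyp _ p) ρ η dρ dη k sat M x = sat p ≤-refl M x
≼-sound (≼-⊤ _ _)   ρ η dρ dη k sat M x = Top-full k M
≼-sound (≼-≃ _ d)   ρ η dρ dη k sat M   = to (proj₁ (≃-sound d) ρ η dρ dη k M)
≼-sound (≼-trans _ γ≐ d₁ d₂) ρ η dρ dη k sat M x with Sat-split γ≐ sat
... | sat₁ , sat₂ = ≼-sound d₂ ρ η dρ dη k sat₂ M (≼-sound d₁ ρ η dρ dη k sat₁ M x)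
≼-sound (≼-● d) ρ η dρ dη zero    sat M x = tt
≼-sound (≼-● d) ρ η dρ dη (suc k) sat M x =
  ≼-sound d ρ η dρ dη k (Sat-weaken (m≤n⇒m≤1+n ≤-refl) sat) M x
≼-sound (≼-⇒ {A = A} {A'} {B} {B'} _ γ≐ d₁ d₂) ρ η dρ dη k sat M x with Sat-split γ≐ sat
... | sat₁ , sat₂ = from (⇒-unfold A' B' ρ η k M) λ j≤k N a' →
  ≼-sound d₂ ρ η dρ dη _ (Sat-weaken j≤k sat₂) (M · N)
    (to (⇒-unfold A B ρ η k M) x j≤k N (≼-sound d₁ ρ η dρ dη _ (Sat-weaken j≤k sat₁) N a'))
≼-sound (≼-μ X Y X≢Y Xγ Yγ fXA fXB fYA fYB _ _ γ'≐ d) =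
  μ-sound X Y X≢Y Xγ Yγ fXA fXB fYA fYB γ'≐ (≼-sound d)
≼-sound (≼-next _ _) ρ η dρ dη zero    sat M x = tt
≼-sound {A = A} (≼-next _ _) ρ η dρ dη (suc k) sat M x = ⟦⟧-downward A dρ dη x

ExpClosed : (Tm → Set) → Set
ExpClosed P = ∀ {M M'} → M ⟶β M' → P M' → P M

ExpClosedEnv : Env → Set
ExpClosedEnv ρ = ∀ X k → ExpClosed (ρ X k)

expClosed-∷ : ∀ {S η} → (∀ k → ExpClosed (S k)) → ExpClosedEnv η → ExpClosedEnv (S ∷ₑ η)
expClosed-∷ eS eη zero    = eS
expClosed-∷ eS eη (suc i) = eη i

⟦⟧-expClosed : ∀ A {ρ η} → ExpClosedEnv ρ → ExpClosedEnv η → ∀ k → ExpClosed (⟦ A ⟧ ρ η k)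
⟦⟧-expClosed (fv X)  eρ eη = eρ X
⟦⟧-expClosed (bv i)  eρ eη = eη i
⟦⟧-expClosed (A ⇒ B) eρ eη zero    s f       = λ N a → ⟦⟧-expClosed B eρ eη zero (ξ-·₁ s) (f N a)
⟦⟧-expClosed (A ⇒ B) eρ eη (suc k) s (f , g) =
  ⟦⟧-expClosed (A ⇒ B) eρ eη k s f , λ N a → ⟦⟧-expClosed B eρ eη (suc k) (ξ-·₁ s) (g N a)
⟦⟧-expClosed (● A)   eρ eη zero    s _ = tt
⟦⟧-expClosed (● A)   eρ eη (suc k)     = ⟦⟧-expClosed A eρ eη k
⟦⟧-expClosed (μ A)   eρ eη =
  μ-preserves ExpClosed (λ _ _ → tt) (λ e e' s (x , y) → e s x , e' s y)
              (λ eS → ⟦⟧-expClosed A eρ (expClosed-∷ eS eη))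

-- The valuation of bound indices used for typing; type expressions in a
-- typing have no dangling indices, so any choice would do.
η₀ : Env
η₀ _ _ _ = ⊤

SemCtx : Ctx → Env → ℕ → (ℕ → Tm) → Set
SemCtx Γ ρ k σ = ∀ x {B} → look Γ x ≡ just B → ⟦ B ⟧ ρ η₀ k (σ x)

●Ctx-look : ∀ Γ x {B} → look (●Ctx Γ) x ≡ just B → Σ Ty (λ B' → (B ≡ ● B') × (look Γ x ≡ just B'))
●Ctx-look (just A ∷ Γ) zero    refl = A , refl , refl
●Ctx-look (nothing ∷ Γ) zero   ()
●Ctx-look (a ∷ Γ)      (suc x) e    = ●Ctx-look Γ x e

union-left : ∀ {a b c B} → U a b c → a ≡ just B → c ≡ just B
union-left u-jn refl = refl
union-left u-jj refl = refl

union-right : ∀ {a b c B} → U a b c → b ≡ just B → c ≡ just B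
union-right u-nj refl = refl
union-right u-jj refl = refl

typing-sound : ∀ {Γ M A} → Γ ⊢ M ∶ A → ∀ ρ → DownwardEnv ρ → ExpClosedEnv ρ →
               ∀ k σ → SemCtx Γ ρ k σ → ⟦ A ⟧ ρ η₀ k (psub σ M)
typing-sound (t-var e) ρ dρ eρ k σ sσ = sσ _ e
typing-sound {Γ} (t-● d) ρ dρ eρ k σ sσ = typing-sound d ρ dρ eρ (suc k) σ sσ●
  where
  sσ● : SemCtx (●Ctx Γ) ρ (suc k) σ
  sσ● x e with ●Ctx-look Γ x e
  ... | _ , refl , e' = sσ x e'
typing-sound t-⊤ ρ dρ eρ k σ sσ = Top-full k _
typing-sound {M = M} (t-≼ d A≼B) ρ dρ eρ k σ sσ =
  ≼-sound A≼B ρ η₀ dρ (λ _ _ → tt) k (λ ()) (psub σ M) (typing-sound d ρ dρ eρ k σ sσ)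
typing-sound {Γ} {ƛ M} {A ⇒ B} (t-ƛ _ d) ρ dρ eρ k σ sσ =
  from (⇒-unfold A B ρ η₀ k (psub σ (ƛ M))) λ {j} j≤k N a →
    ⟦⟧-expClosed B {η = η₀} eρ (λ _ _ _ _ → tt) j β
      (subst (⟦ B ⟧ ρ η₀ j) (sym (beta-psub N σ M)) (typing-sound d ρ dρ eρ j (N • σ) (extend j≤k N a)))
  where
  extend : ∀ {j} → j ≤ k → ∀ N → ⟦ A ⟧ ρ η₀ j N → SemCtx (just A ∷ Γ) ρ j (N • σ)
  extend j≤k N a zero    refl = a
  extend j≤k N a (suc x) {B'} e =
    downward-≤ {⟦ B' ⟧ ρ η₀} (⟦⟧-downward B' dρ (λ _ _ → tt)) j≤k (sσ x e)
typing-sound {M = M · N} {B} (t-· {A = A} u d₁ d₂) ρ dρ eρ k σ sσ =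
  to (⇒-unfold A B ρ η₀ k (psub σ M)) (typing-sound d₁ ρ dρ eρ k σ (λ x e → sσ x (union-left (u x) e)))
     ≤-refl (psub σ N) (typing-sound d₂ ρ dρ eρ k σ (λ x e → sσ x (union-right (u x) e)))

-- Part 4.  Adequacy for •-free types, and the theorem.

NoBullet-open : ∀ A n X → NoBullet A → NoBullet (openRec n (fv X) A)
NoBullet-open (fv Y)  n X nb = tt
NoBullet-open (bv i)  n X nb with i ≡ᵇ n
... | true  = tt
... | false = tt
NoBullet-open (A ⇒ B) n X (nbA , nbB) = NoBullet-open A n X nbA , NoBullet-open B n X nbB
NoBullet-open (μ A)   n X nb          = NoBullet-open A (suc n) X nb

-- A ⊤-variant contains a •, so a •-free type is never one.
NoBullet-¬guarded : ∀ B j → NoBullet B → ¬ Guarded j (tail B)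
NoBullet-¬guarded (A ⇒ B) j (_ , nbB) g        = NoBullet-¬guarded B j nbB g
NoBullet-¬guarded (μ B)   j nb        (gd-μ g) = NoBullet-¬guarded B (suc j) nb g

NoBullet-¬topVariant : ∀ B → NoBullet B → ¬ TopVariant B
NoBullet-¬topVariant (A ⇒ B) (_ , nbB) t          = NoBullet-¬topVariant B nbB t
NoBullet-¬topVariant (μ B)   nb        (ts-μ t)   = NoBullet-¬topVariant B nb t
NoBullet-¬topVariant (μ B)   nb        (ts-hit g) = NoBullet-¬guarded B zero nb g

NoBullet-proper⇒fresh : ∀ C X → NoBullet C → Proper X C → X ∉FV C
NoBullet-proper⇒fresh (fv Y)  X nb          X≢Y              = X≢Y
NoBullet-proper⇒fresh (bv i)  X nb          _                = tt
NoBullet-proper⇒fresh (A ⇒ B) X (nbA , nbB) (inj₁ (pA , pB)) =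
  NoBullet-proper⇒fresh A X nbA pA , NoBullet-proper⇒fresh B X nbB pB
NoBullet-proper⇒fresh (A ⇒ B) X (_ , nbB)   (inj₂ tv)        = ⊥-elim (NoBullet-¬topVariant B nbB tv)
NoBullet-proper⇒fresh (μ A)   X nb          (inj₁ p)         = NoBullet-proper⇒fresh A X nb p
NoBullet-proper⇒fresh (μ A)   X nb          (inj₂ tv)        = ⊥-elim (NoBullet-¬topVariant (μ A) nb tv)

ρWN : Env
ρWN _ _ M = Normalizable M

Adequate : SemTy → ℕ → Set
Adequate S k = (∀ M → S k M → Normalizable M) × (∀ M → Neutral M → S k M)

adequate-⇔ : ∀ {S S' k} → (∀ M → S k M ⇔ S' k M) → Adequate S' k → Adequate S k
adequate-⇔ S⇔S' (sound , complete) = (λ M s → sound M (to (S⇔S' M) s)) , (λ M n → from (S⇔S' M) (complete M n))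

adequacy : ∀ A → WF A → NoBullet A → ∀ η k → Adequate (⟦ A ⟧ ρWN η) k
adequacy (fv X) wf-fv _ η k = (λ M wn → wn) , (λ M n → Neutral⇒WN n)
adequacy (A ⇒ B) (wf-⇒ wA wB) (nbA , nbB) η k = sound , complete
  where
  sound : ∀ M → ⟦ A ⇒ B ⟧ ρWN η k M → Normalizable M
  sound M f = WN-app-var M 0 (proj₁ (adequacy B wB nbB η k) (M · var 0)
                (to (⇒-unfold A B ρWN η k M) f ≤-refl (var 0) (proj₂ (adequacy A wA nbA η k) (var 0) ne-var)))
  complete : ∀ M → Neutral M → ⟦ A ⇒ B ⟧ ρWN η k M
  complete M n = from (⇒-unfold A B ρWN η k M) λ {j} _ N a →
    proj₂ (adequacy B wB nbB η j) (M · N) (ne-app n (proj₁ (adequacy A wA nbA η j) N a))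
adequacy (μ A) (wf-μ X fr pr wb) nb η = μ-adequate
  where
  -- The body of μA is •-free, so X is not free in its opening and the body
  -- is adequate whatever the value of the bound variable.
  body : ∀ S k → Adequate (⟦ A ⟧ ρWN (S ∷ₑ η)) k
  body S k = adequate-⇔ {⟦ A ⟧ ρWN (S ∷ₑ η)} {⟦ openT A (fv X) ⟧ ρWN (S ∷ₑ η)}
                        (λ M → ⇔.trans (⟦⟧-open-fresh A X {S} {S} fr k M)
                                 (⟦⟧-fresh (openT A (fv X)) X fresh k M))
                        (adequacy (openT A (fv X)) wb (NoBullet-open A 0 X nb) (S ∷ₑ η) k)
    where
    fresh : X ∉FV openT A (fv X)
    fresh = NoBullet-proper⇒fresh _ X (NoBullet-open A 0 X nb) pr
  μ-adequate : ∀ k → Adequate (⟦ μ A ⟧ ρWN η) k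
  μ-adequate zero    = body _ zero
  μ-adequate (suc k) = (λ M x → proj₁ (body _ (suc k)) M (proj₂ x)) ,
                       (λ M n → proj₂ (μ-adequate k) M n , proj₂ (body _ (suc k)) M n)

theorem8p37 : (Γ : Ctx) (M : Tm) (A : Ty) →
              CtxWF Γ → WF A → CtxNoBullet Γ → NoBullet A →
              Γ ⊢ M ∶ A → Normalizable M
theorem8p37 Γ M A Γwf Awf Γnb Anb ⊢M = proj₁ (adequacy A Awf Anb η₀ 0) M realizes
  where
  -- The identity substitution realizes Γ: variables are neutral.
  idRealizesΓ : SemCtx Γ ρWN 0 var
  idRealizesΓ x {B} e = proj₂ (adequacy B (Γwf x e) (Γnb x e) η₀ 0) (var x) ne-var
  -- Soundness applies since WN does not depend on the step and is closed
  -- under β-expansion; M is its own instance under the identity substitution.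
  realizes : ⟦ A ⟧ ρWN η₀ 0 M
  realizes = subst (⟦ A ⟧ ρWN η₀ 0) (psub-id M)
               (typing-sound ⊢M ρWN (λ _ wn → wn) (λ _ _ → WN-expand) 0 var idRealizesΓ)
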